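{- Let $G$ be a graph with chromatic number $\chi(G)=k$. Fix a proper $k$-coloring of $G$ with color classes $V_1,\dots,V_k$. For each $i$, let $G_i$ be the graph with vertex set $V_i$ in which distinct $u,v\in V_i$ are adjacent if and only if $d_G(u,v)=2$. Then \[ \tau_2(G)\le k+\sum_{i=1}^k\left\lceil\sqrt{2\chi(G_i)}\right\rceil. \]
   Context: $d_G(u,v)$ denotes graph distance in $G$. A $2$-tone coloring of a graph $G$ assigns to each vertex $v$ a set $f(v)$ of exactly $2$ colors from a color set $C$ such that $|f(u)\cap f(v)|<d_G(u,v)$ for all distinct vertices $u,v$ (so adjacent vertices share no color and vertices at distance $2$ share at most one color). $\tau_2(G)$ is the minimum $|C|$ over all $2$-tone colorings of $G$. -}

module Defs where

open import Data.Nat using (ℕ; zero; suc; _+_; _*_; _≤_; _<_; _≤ᵇ_)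
open import Data.Bool using (Bool; true; false; if_then_else_)
open import Data.Fin using (Fin)
open import Data.Fin.Subset using (Subset; _∩_; ∣_∣)
open import Data.Product using (Σ; ∃; _×_; _,_)
open import Relation.Binary.PropositionalEquality using (_≡_; _≢_)
open import Relation.Nullary using (¬_)

record SimpleGraph (n : ℕ) : Set where
  field
    adj    : Fin n → Fin n → Bool
    sym    : ∀ u v → adj u v ≡ adj v u
    irrefl : ∀ v → adj v v ≡ false

open SimpleGraph public

Adj : ∀ {n} → SimpleGraph n → Fin n → Fin n → Set
Adj G u v = adj G u v ≡ true

data Walk {n : ℕ} (G : SimpleGraph n) : Fin n → Fin n → ℕ → Set where
  nil  : ∀ {u} → Walk G u u 0
  cons : ∀ {u w v m} → Adj G u w → Walk G w v m → Walk G u v (suc m)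

-- Graph distance: d_G(u,v) = m  iff  there is a walk of length m and
-- no walk of smaller length.  (If u,v are in different components no m
-- satisfies this, i.e. d_G(u,v) = ∞.)
Dist : ∀ {n} → SimpleGraph n → Fin n → Fin n → ℕ → Set
Dist G u v m = Walk G u v m × (∀ j → j < m → ¬ Walk G u v j)

ProperColoring : {V : Set} → (V → V → Set) → ℕ → Set
ProperColoring {V} A k =
  Σ (V → Fin k) λ c → ∀ u v → A u v → c u ≢ c v

IsChromaticNumber : {V : Set} → (V → V → Set) → ℕ → Set
IsChromaticNumber A k =
  ProperColoring A k × (∀ j → j < k → ¬ ProperColoring A j)

TwoToneColoring : ∀ {n} → SimpleGraph n → ℕ → Set
TwoToneColoring {n} G c =
  Σ (Fin n → Subset c) λ f →
    (∀ v → ∣ f v ∣ ≡ 2) ×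
    (∀ u v → u ≢ v → ∀ m → Dist G u v m → ∣ f u ∩ f v ∣ < m)

Tau2≤ : ∀ {n} → SimpleGraph n → ℕ → Set
Tau2≤ G B = ∃ λ c → c ≤ B × TwoToneColoring G c

ColorClass : ∀ {n k} → (Fin n → Fin k) → Fin k → Set
ColorClass {n} col i = Σ (Fin n) λ v → col v ≡ i

ClassGraph : ∀ {n k} → SimpleGraph n → (col : Fin n → Fin k) → (i : Fin k) →
             ColorClass col i → ColorClass col i → Set
ClassGraph G col i (u , _) (v , _) = u ≢ v × Dist G u v 2

ceilSqrtGo : ℕ → ℕ → ℕ → ℕ
ceilSqrtGo n zero     m = m
ceilSqrtGo n (suc fuel) m = if n ≤ᵇ m * m then m else ceilSqrtGo n fuel (suc m)

ceilSqrt : ℕ → ℕ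
ceilSqrt n = ceilSqrtGo n n 0

sumFin : ∀ k → (Fin k → ℕ) → ℕ
sumFin zero     f = 0
sumFin (suc k) f = f Fin.zero + sumFin k (λ i → f (Fin.suc i))

-- Each color class V_i gets its own block of ⌈√(2χ(G_i))⌉ + 1 colors, which
-- has at least χ(G_i) two-element subsets. A vertex of V_i receives the
-- subset of its block indexed by its color in G_i. Adjacent vertices lie in
-- different classes, hence get disjoint sets. Vertices at distance 2 in
-- different classes are likewise disjoint, and in the same class they are
-- adjacent in G_i, so they get distinct 2-subsets, sharing at most one color.
module Submission where

open import Defs hiding (sym)
open import Data.Nat using (ℕ; zero; suc; _+_; _*_; _≤_; _<_; _≤ᵇ_; z≤n; s≤s; _<?_)
open import Data.Nat.Properties
open import Data.Nat.Tactic.RingSolver using (solve-∀)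
open import Data.Fin as F using (Fin; toℕ; fromℕ<; _↑ˡ_; _↑ʳ_; splitAt)
import Data.Fin.Properties as FinP
open import Data.Fin.Subset using (Subset; _∩_; _∪_; ∣_∣; ⁅_⁆; _∈_; inside; outside)
open import Data.Fin.Subset.Properties
  using (∣⁅x⁆∣≡1; ∣⊥∣≡0; ∪-identityˡ; ∪-identityʳ; Empty-unique; x∈p∩q⁻; x∈p∪q⁻; x∈⁅y⁆⇒x≡y; ∣p∩q∣≤∣p∣)
open import Data.Vec using (_∷_; []; here; there)
open import Data.Bool using (true; false; T)
open import Data.Unit using (tt)
open import Data.Product using (_×_; _,_; proj₁; proj₂)
open import Data.Sum using (_⊎_; inj₁; inj₂; [_,_]′)
open import Data.Empty using (⊥; ⊥-elim)
open import Relation.Nullary using (¬_; yes; no)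
open import Relation.Binary.PropositionalEquality

pair : ∀ {N} → Fin N → Fin N → Subset N
pair p q = ⁅ p ⁆ ∪ ⁅ q ⁆

∣pair∣≡2 : ∀ {N} {p q : Fin N} → p ≢ q → ∣ pair p q ∣ ≡ 2
∣pair∣≡2 {p = F.zero}  {F.zero}  p≢q = ⊥-elim (p≢q refl)
∣pair∣≡2 {p = F.zero}  {F.suc q} _   rewrite ∪-identityˡ ⁅ q ⁆ = cong suc (∣⁅x⁆∣≡1 q)
∣pair∣≡2 {p = F.suc p} {F.zero}  _   rewrite ∪-identityʳ ⁅ p ⁆ = cong suc (∣⁅x⁆∣≡1 p)
∣pair∣≡2 {p = F.suc p} {F.suc q} p≢q = ∣pair∣≡2 (λ p≡q → p≢q (cong F.suc p≡q))

x∈pair⁻ : ∀ {N} {p q x : Fin N} → x ∈ pair p q → x ≡ p ⊎ x ≡ q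
x∈pair⁻ {p = p} {q} x∈ with x∈p∪q⁻ ⁅ p ⁆ ⁅ q ⁆ x∈
... | inj₁ x∈⁅p⁆ = inj₁ (x∈⁅y⁆⇒x≡y p x∈⁅p⁆)
... | inj₂ x∈⁅q⁆ = inj₂ (x∈⁅y⁆⇒x≡y q x∈⁅q⁆)

∀∉⇒∣p∣≡0 : ∀ {N} (S : Subset N) → (∀ x → ¬ x ∈ S) → ∣ S ∣ ≡ 0
∀∉⇒∣p∣≡0 {N} S x∉S rewrite Empty-unique {p = S} (λ (x , x∈S) → x∉S x x∈S) = ∣⊥∣≡0 N

allEqual⇒∣p∣≤1 : ∀ {N} (S : Subset N) → (∀ x y → x ∈ S → y ∈ S → x ≡ y) → ∣ S ∣ ≤ 1
allEqual⇒∣p∣≤1 []            _ = z≤n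
allEqual⇒∣p∣≤1 (outside ∷ S) unique =
  allEqual⇒∣p∣≤1 S (λ x y x∈S y∈S → FinP.suc-injective (unique (F.suc x) (F.suc y) (there x∈S) (there y∈S)))
allEqual⇒∣p∣≤1 (inside ∷ S)  unique
  rewrite ∀∉⇒∣p∣≡0 S (λ x x∈S → FinP.0≢1+n (unique F.zero (F.suc x) here (there x∈S))) = s≤s z≤n

-- Listing each pair in increasing order makes distinctness a statement
-- about coordinates.
∣pair∩pair∣≤1 : ∀ {N} {p q p′ q′ : Fin N} → p F.< q → p′ F.< q′ →
  ¬ (p ≡ p′ × q ≡ q′) → ∣ pair p q ∩ pair p′ q′ ∣ ≤ 1
∣pair∩pair∣≤1 {p = p} {q} {p′} {q′} p<q p′<q′ distinct = allEqual⇒∣p∣≤1 _ common-unique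
  where
  enumerate : ∀ {a b x y} → x ≢ y → x ∈ pair a b → y ∈ pair a b → (x ≡ a × y ≡ b) ⊎ (x ≡ b × y ≡ a)
  enumerate x≢y x∈ y∈ with x∈pair⁻ x∈ | x∈pair⁻ y∈
  ... | inj₁ x≡a | inj₁ y≡a = ⊥-elim (x≢y (trans x≡a (sym y≡a)))
  ... | inj₁ x≡a | inj₂ y≡b = inj₁ (x≡a , y≡b)
  ... | inj₂ x≡b | inj₁ y≡a = inj₂ (x≡b , y≡a)
  ... | inj₂ x≡b | inj₂ y≡b = ⊥-elim (x≢y (trans x≡b (sym y≡b)))

  crossed : p ≡ q′ → q ≡ p′ → ⊥
  crossed refl refl = FinP.<-asym p<q p′<q′

  common-unique : ∀ x y → x ∈ pair p q ∩ pair p′ q′ → y ∈ pair p q ∩ pair p′ q′ → x ≡ y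
  common-unique x y x∈ y∈ with x F.≟ y
  ... | yes x≡y = x≡y
  ... | no x≢y
    with x∈p∩q⁻ (pair p q) (pair p′ q′) x∈ | x∈p∩q⁻ (pair p q) (pair p′ q′) y∈
  ... | (x∈₁ , x∈₂) | (y∈₁ , y∈₂)
    with enumerate x≢y x∈₁ y∈₁ | enumerate x≢y x∈₂ y∈₂
  ... | inj₁ (refl , refl) | inj₁ (x≡p′ , y≡q′) = ⊥-elim (distinct (x≡p′ , y≡q′))
  ... | inj₂ (refl , refl) | inj₂ (x≡q′ , y≡p′) = ⊥-elim (distinct (y≡p′ , x≡q′))
  ... | inj₁ (refl , refl) | inj₂ (x≡q′ , y≡p′) = ⊥-elim (crossed x≡q′ y≡p′)
  ... | inj₂ (refl , refl) | inj₁ (x≡p′ , y≡q′) = ⊥-elim (crossed y≡q′ x≡p′)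

injectBlock : ∀ {k} (t : Fin k → ℕ) (i : Fin k) → Fin (t i) → Fin (sumFin k t)
injectBlock {suc k} t F.zero    a = a ↑ˡ sumFin k (λ j → t (F.suc j))
injectBlock {suc k} t (F.suc i) a = t F.zero ↑ʳ injectBlock (λ j → t (F.suc j)) i a

blockOf : ∀ {k} (t : Fin k → ℕ) → Fin (sumFin k t) → Fin k
blockOf {suc k} t x = [ (λ _ → F.zero) , (λ y → F.suc (blockOf (λ j → t (F.suc j)) y)) ]′ (splitAt (t F.zero) x)

blockOf-injectBlock : ∀ {k} (t : Fin k → ℕ) i a → blockOf t (injectBlock t i a) ≡ i
blockOf-injectBlock {suc k} t F.zero a
  rewrite FinP.splitAt-↑ˡ (t F.zero) a (sumFin k (λ j → t (F.suc j))) = refl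
blockOf-injectBlock {suc k} t (F.suc i) a
  rewrite FinP.splitAt-↑ʳ (t F.zero) (sumFin k (λ j → t (F.suc j))) (injectBlock (λ j → t (F.suc j)) i a)
  = cong F.suc (blockOf-injectBlock (λ j → t (F.suc j)) i a)

injectBlock-injective : ∀ {k} (t : Fin k → ℕ) i {a b} → injectBlock t i a ≡ injectBlock t i b → a ≡ b
injectBlock-injective {suc k} t F.zero    eq = FinP.↑ˡ-injective _ _ _ eq
injectBlock-injective {suc k} t (F.suc i) eq =
  injectBlock-injective (λ j → t (F.suc j)) i (FinP.↑ʳ-injective (t F.zero) _ _ eq)

injectBlock-mono-< : ∀ {k} (t : Fin k → ℕ) i {a b} → a F.< b → injectBlock t i a F.< injectBlock t i b
injectBlock-mono-< {suc k} t F.zero {a} {b} a<b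
  rewrite FinP.toℕ-↑ˡ a (sumFin k (λ j → t (F.suc j))) | FinP.toℕ-↑ˡ b (sumFin k (λ j → t (F.suc j))) = a<b
injectBlock-mono-< {suc k} t (F.suc i) {a} {b} a<b
  rewrite FinP.toℕ-↑ʳ (t F.zero) (injectBlock (λ j → t (F.suc j)) i a)
        | FinP.toℕ-↑ʳ (t F.zero) (injectBlock (λ j → t (F.suc j)) i b)
  = +-monoʳ-< (t F.zero) (injectBlock-mono-< (λ j → t (F.suc j)) i a<b)

sumFin-suc : ∀ k (s : Fin k → ℕ) → sumFin k (λ i → suc (s i)) ≡ k + sumFin k s
sumFin-suc zero    s = refl
sumFin-suc (suc k) s =
  cong suc (trans (cong (s F.zero +_) (sumFin-suc k (λ i → s (F.suc i)))) (swap (s F.zero) k _))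
  where
  swap : ∀ a b c → a + (b + c) ≡ b + (a + c)
  swap = solve-∀

nextPair : ℕ × ℕ → ℕ × ℕ
nextPair (x , y) with x <? y
... | yes _ = suc x , y
... | no _  = 0 , suc y

unrankPair : ℕ → ℕ × ℕ
unrankPair zero    = 0 , 0
unrankPair (suc c) = nextPair (unrankPair c)

-- (x , y) is the c-th pair in the order (0,0), (0,1), (1,1), (0,2), …
-- exactly when 2c = y(y+1) + 2x.
HasRank : ℕ → ℕ × ℕ → Set
HasRank c (x , y) = x ≤ y × y * suc y + 2 * x ≡ 2 * c

nextPair-hasRank : ∀ {c} p → HasRank c p → HasRank (suc c) (nextPair p)
nextPair-hasRank {c} (x , y) (x≤y , rank) with x <? y
... | yes x<y = x<y , (begin
  y * suc y + 2 * suc x   ≡⟨ two-more (y * suc y) x ⟩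
  2 + (y * suc y + 2 * x) ≡⟨ cong (2 +_) rank ⟩
  2 + 2 * c               ≡⟨ *-suc 2 c ⟨
  2 * suc c               ∎)
  where
  open ≡-Reasoning
  two-more : ∀ a b → a + 2 * suc b ≡ 2 + (a + 2 * b)
  two-more = solve-∀
... | no x≮y = z≤n , (begin
  suc y * suc (suc y) + 0 ≡⟨ next-row y ⟩
  2 + (y * suc y + 2 * y) ≡⟨ cong (λ z → 2 + (y * suc y + 2 * z)) (≤-antisym x≤y (≮⇒≥ x≮y)) ⟨
  2 + (y * suc y + 2 * x) ≡⟨ cong (2 +_) rank ⟩
  2 + 2 * c               ≡⟨ *-suc 2 c ⟨
  2 * suc c               ∎)
  where
  open ≡-Reasoning
  next-row : ∀ a → suc a * suc (suc a) + 0 ≡ 2 + (a * suc a + 2 * a)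
  next-row = solve-∀

unrankPair-hasRank : ∀ c → HasRank c (unrankPair c)
unrankPair-hasRank zero    = z≤n , refl
unrankPair-hasRank (suc c) = nextPair-hasRank (unrankPair c) (unrankPair-hasRank c)

unrankPair-injective : ∀ c d → unrankPair c ≡ unrankPair d → c ≡ d
unrankPair-injective c d eq = *-cancelˡ-≡ c d 2 (begin
  2 * c                                            ≡⟨ proj₂ (unrankPair-hasRank c) ⟨
  rankOf (unrankPair c)                            ≡⟨ cong rankOf eq ⟩
  rankOf (unrankPair d)                            ≡⟨ proj₂ (unrankPair-hasRank d) ⟩
  2 * d                                            ∎)
  where
  open ≡-Reasoning
  rankOf : ℕ × ℕ → ℕ
  rankOf (x , y) = y * suc y + 2 * x

unrankPair-bound : ∀ c s → 2 * c < s * s → proj₂ (unrankPair c) < s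
unrankPair-bound c s 2c<s² with unrankPair c | unrankPair-hasRank c
... | x , y | _ , rank with y <? s
... | yes y<s = y<s
... | no y≮s = ⊥-elim (<-irrefl refl (<-≤-trans 2c<s² (begin
  s * s             ≤⟨ *-mono-≤ s≤y (≤-trans s≤y (n≤1+n y)) ⟩
  y * suc y         ≤⟨ m≤m+n (y * suc y) (2 * x) ⟩
  y * suc y + 2 * x ≡⟨ rank ⟩
  2 * c             ∎)))
  where
  open ≤-Reasoning
  s≤y = ≮⇒≥ y≮s

module _ {m s : ℕ} (2m≤s² : 2 * m ≤ s * s) where

  private
    lowOf highOf : Fin m → ℕ
    lowOf  c = proj₁ (unrankPair (toℕ c))
    highOf c = proj₂ (unrankPair (toℕ c))

    highOf<s : ∀ c → highOf c < s
    highOf<s c = unrankPair-bound (toℕ c) s (<-≤-trans (*-monoʳ-< 2 (FinP.toℕ<n c)) 2m≤s²)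

    lowOf≤highOf : ∀ c → lowOf c ≤ highOf c
    lowOf≤highOf c = proj₁ (unrankPair-hasRank (toℕ c))

    lowOf<1+s : ∀ c → lowOf c < suc s
    lowOf<1+s c = s≤s (≤-trans (lowOf≤highOf c) (<⇒≤ (highOf<s c)))

  lowPoint highPoint : Fin m → Fin (suc s)
  lowPoint  c = fromℕ< (lowOf<1+s c)
  highPoint c = fromℕ< (s≤s (highOf<s c))

  private
    toℕ-lowPoint : ∀ c → toℕ (lowPoint c) ≡ lowOf c
    toℕ-lowPoint c = FinP.toℕ-fromℕ< (lowOf<1+s c)

    toℕ-highPoint : ∀ c → toℕ (highPoint c) ≡ suc (highOf c)
    toℕ-highPoint c = FinP.toℕ-fromℕ< (s≤s (highOf<s c))

  lowPoint<highPoint : ∀ c → lowPoint c F.< highPoint c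
  lowPoint<highPoint c rewrite toℕ-lowPoint c | toℕ-highPoint c = s≤s (lowOf≤highOf c)

  points-injective : ∀ {c d} → lowPoint c ≡ lowPoint d → highPoint c ≡ highPoint d → c ≡ d
  points-injective {c} {d} low≡ high≡ =
    FinP.toℕ-injective (unrankPair-injective (toℕ c) (toℕ d) (cong₂ _,_ lowOf≡ highOf≡))
    where
    lowOf≡ : lowOf c ≡ lowOf d
    lowOf≡ = trans (sym (toℕ-lowPoint c)) (trans (cong toℕ low≡) (toℕ-lowPoint d))
    highOf≡ : highOf c ≡ highOf d
    highOf≡ = suc-injective (trans (sym (toℕ-highPoint c)) (trans (cong toℕ high≡) (toℕ-highPoint d)))

ceilSqrtGo-spec : ∀ n fuel m → n ≤ (fuel + m) * (fuel + m) → n ≤ ceilSqrtGo n fuel m * ceilSqrtGo n fuel m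
ceilSqrtGo-spec n zero       m n≤m² = n≤m²
ceilSqrtGo-spec n (suc fuel) m n≤ with n ≤ᵇ m * m in test
... | true  = ≤ᵇ⇒≤ n (m * m) (subst T (sym test) tt)
... | false = ceilSqrtGo-spec n fuel (suc m) (subst (λ x → n ≤ x * x) (sym (+-suc fuel m)) n≤)

n≤ceilSqrt[n]² : ∀ n → n ≤ ceilSqrt n * ceilSqrt n
n≤ceilSqrt[n]² zero    = z≤n
n≤ceilSqrt[n]² (suc n) =
  ceilSqrtGo-spec (suc n) (suc n) 0 (subst (λ x → suc n ≤ x * x) (sym (+-identityʳ (suc n))) (m≤m*n (suc n) (suc n)))

module TwoToneFromClasses {n k} (G : SimpleGraph n) (col : ProperColoring (Adj G) k) (χs : Fin k → ℕ)
  (classColoring : ∀ i → ProperColoring (ClassGraph G (proj₁ col) i) (χs i)) where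

  classOf : Fin n → Fin k
  classOf = proj₁ col

  blockSize : Fin k → ℕ
  blockSize i = suc (ceilSqrt (2 * χs i))

  palette : ℕ
  palette = sumFin k blockSize

  classColor : ∀ i → ColorClass classOf i → Fin (χs i)
  classColor i = proj₁ (classColoring i)

  private
    fits : ∀ i → 2 * χs i ≤ ceilSqrt (2 * χs i) * ceilSqrt (2 * χs i)
    fits i = n≤ceilSqrt[n]² (2 * χs i)

  low high : ∀ i → ColorClass classOf i → Fin palette
  low  i U = injectBlock blockSize i (lowPoint  (fits i) (classColor i U))
  high i U = injectBlock blockSize i (highPoint (fits i) (classColor i U))

  classPair : ∀ i → ColorClass classOf i → Subset palette
  classPair i U = pair (low i U) (high i U)

  colors : Fin n → Subset palette
  colors v = classPair (classOf v) (v , refl)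

  colors-reindex : ∀ u {i} (e : classOf u ≡ i) → colors u ≡ classPair i (u , e)
  colors-reindex u refl = refl

  low<high : ∀ i U → low i U F.< high i U
  low<high i U = injectBlock-mono-< blockSize i (lowPoint<highPoint (fits i) (classColor i U))

  ∣colors∣≡2 : ∀ v → ∣ colors v ∣ ≡ 2
  ∣colors∣≡2 v = ∣pair∣≡2 (λ low≡high → FinP.<-irrefl low≡high (low<high (classOf v) (v , refl)))

  blockOf-classPair : ∀ i U {x} → x ∈ classPair i U → blockOf blockSize x ≡ i
  blockOf-classPair i U x∈ with x∈pair⁻ x∈
  ... | inj₁ refl = blockOf-injectBlock blockSize i _
  ... | inj₂ refl = blockOf-injectBlock blockSize i _

  ∣colors∩colors∣≡0 : ∀ u v → classOf u ≢ classOf v → ∣ colors u ∩ colors v ∣ ≡ 0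
  ∣colors∩colors∣≡0 u v classes≢ = ∀∉⇒∣p∣≡0 _ λ x x∈ →
    let x∈u , x∈v = x∈p∩q⁻ (colors u) (colors v) x∈ in
    classes≢ (trans (sym (blockOf-classPair _ _ x∈u)) (blockOf-classPair _ _ x∈v))

  ∣classPair∩classPair∣≤1 : ∀ i U V → classColor i U ≢ classColor i V → ∣ classPair i U ∩ classPair i V ∣ ≤ 1
  ∣classPair∩classPair∣≤1 i U V colors≢ = ∣pair∩pair∣≤1 (low<high i U) (low<high i V) λ (low≡ , high≡) →
    colors≢ (points-injective (fits i)
      (injectBlock-injective blockSize i low≡) (injectBlock-injective blockSize i high≡))

  colors-respects-distance : ∀ u v → u ≢ v → ∀ m → Dist G u v m → ∣ colors u ∩ colors v ∣ < m
  colors-respects-distance u v u≢v 0 (nil , _) = ⊥-elim (u≢v refl)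
  colors-respects-distance u v u≢v 1 (cons u~v nil , _)
    rewrite ∣colors∩colors∣≡0 u v (proj₂ col u v u~v) = s≤s z≤n
  colors-respects-distance u v u≢v 2 dist₂ with classOf u F.≟ classOf v
  ... | no classes≢ rewrite ∣colors∩colors∣≡0 u v classes≢ = s≤s z≤n
  ... | yes classes≡ rewrite colors-reindex u classes≡ =
    s≤s (∣classPair∩classPair∣≤1 _ (u , classes≡) (v , refl)
          (proj₂ (classColoring (classOf v)) (u , classes≡) (v , refl) (u≢v , dist₂)))
  colors-respects-distance u v u≢v (suc (suc (suc m))) _ =
    s≤s (≤-trans (∣p∩q∣≤∣p∣ (colors u) (colors v)) (≤-trans (≤-reflexive (∣colors∣≡2 u)) (s≤s (s≤s z≤n))))

  twoToneColoring : TwoToneColoring G palette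
  twoToneColoring = colors , ∣colors∣≡2 , colors-respects-distance

theorem1p12 : ∀ {n k} (G : SimpleGraph n) →
    IsChromaticNumber (Adj G) k →
    (col : ProperColoring (Adj G) k) →
    (χs : Fin k → ℕ) →
    (∀ i → IsChromaticNumber (ClassGraph G (proj₁ col) i) (χs i)) →
    Tau2≤ G (k + sumFin k (λ i → ceilSqrt (2 * χs i)))
theorem1p12 {k = k} G _ col χs χs-chromatic =
  palette , ≤-reflexive (sumFin-suc k (λ i → ceilSqrt (2 * χs i))) , twoToneColoring
  where open TwoToneFromClasses G col χs (λ i → proj₁ (χs-chromatic i))
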